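{- Let $L$ be a purely structural algebraic language (its signature has no functional constants) with set of atomic types $A$ and set of structural rules $S$. Then the classifying category (term category) of $L$ is isomorphic, as a monoidal category, to the comma category $(\mathbf{S}/A)^{\mathrm{op}}$.
   Context: Algebraic languages: fix a finitary many-sorted signature $\Sigma$ (atomic types; functional constants). Types are finite sequences of atomic types (juxtaposition; $\emptyset$ empty). Raw terms: $t::=\emptyset\mid x\mid f(t_1,\dots,t_n)\mid tt$, tensor associative with unit $\emptyset$; $t[s/x]$ is simultaneous substitution. Sequents $x:A\vdash t:B$ with $x$ distinct atomic variables. Term calculus: Variables $x:A\vdash x:A$ ($x,A$ atomic); Functions; Substitution: from $x:A\vdash s:B$, $y:B\vdash t:C$ infer $x:A\vdash t[s/y]:C$; Unit $\emptyset:\emptyset\vdash\emptyset:\emptyset$; Tensor: from $x:A\vdash s:B$, $y:C\vdash t:D$ infer $xy:AC\vdash st:BD$; Weakening: from $x_1x_3:A_1A_3\vdash t:B$ infer $x_1x_2x_3:A_1A_2A_3\vdash t:B$; Exchange: from $x:A\vdash t:B$ infer $\sigma x:\sigma A\vdash t:B$; Contraction: from $x_1xx'x_2:A_1AAA_2\vdash t:B$ infer $x_1xx_2:A_1AA_2\vdash t[x/x']:B$. An algebraic language is $\Sigma$ plus a set $S\subseteq$ {weakening, exchange, contraction}; its terms are the sequents derivable with all non-structural rules and the rules in $S$. Term (classifying) category $\mathbf{L}$: objects are types; arrows are terms modulo alphabetical variance ($x:A\vdash s:B$ and $y:A\vdash t:B$ identified if $s[z/x]=t[z/y]$ for some $z:A$);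 composition by substitution; strict monoidal tensor by concatenation and tensor of terms. Structural categories: $\mathbf{K}$ is the category of finite cardinals and functions, strict monoidal under sums. $\mathbf{S}\subseteq\mathbf{K}$ is the monoidal subcategory generated by: the initial arrows $0\to n$ if weakening $\in S$; the permutations $n\to n$ if exchange $\in S$; the codiagonals $\nabla\colon n+n\to n$ if contraction $\in S$. The comma category $\mathbf{S}/A$ has objects pairs $(n,T)$ with $n$ a finite cardinal and $T\colon n\to A$ a function (i.e. a type of length $n$), and arrows $(n,T)\to(m,S')$ the arrows $s\colon n\to m$ of $\mathbf{S}$ with $S'\circ s=T$; it is monoidal via sums of cardinals. -}

module Defs where

open import Level using (0ℓ)
open import Data.Bool using (Bool; true)
open import Data.Nat using (ℕ; zero; suc; _+_; _≤_; z≤n; s≤s)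
open import Data.Nat.Properties using (≤-refl; ≤-step; +-suc; +-identityʳ; <-irrefl; ≤-trans; n≤1+n)
open import Data.Fin using (Fin; splitAt; _↑ˡ_; _↑ʳ_)
open import Data.Sum using (inj₁; inj₂; [_,_]′)
open import Data.Product using (Σ; _×_; _,_; proj₁; proj₂; Σ-syntax)
open import Data.List using (List; []; _∷_; [_]; map; zip; length)
  renaming (_++_ to _++ᴸ_)
open import Data.List.Properties using (map-++)
open import Data.List.Relation.Unary.All as All using (All; []; _∷_)
open import Data.List.Relation.Unary.AllPairs using ([]; _∷_)
open import Data.List.Relation.Unary.Unique.Propositional using (Unique)
open import Data.List.Relation.Binary.Permutation.Propositional using (_↭_)
open import Data.Vec using (Vec; lookup) renaming (_++_ to _++ⱽ_; [] to []ⱽ)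
open import Data.Vec.Properties using (lookup-splitAt; lookup-++ˡ; lookup-++ʳ)
open import Relation.Nullary using (yes; no)
open import Relation.Binary.PropositionalEquality
  using (_≡_; refl; sym; trans; cong; cong₂; subst; subst₂)
open import Function using (id; _∘_)
import Data.Nat as ℕ

-- Bare monoidal-category data (objects with propositional equality,
-- hom-sets as setoids: arrows + an identification relation),
-- and strict monoidal isomorphisms between such data.

record MonCatData : Set₁ where
  infixr 9 _∘ᶜ_
  infixr 10 _⊗₀_ _⊗₁_
  field
    Obj   : Set
    Hom   : Obj → Obj → Set
    _≈_   : ∀ {a b} → Hom a b → Hom a b → Set
    idᶜ   : ∀ {a} → Hom a a
    _∘ᶜ_  : ∀ {a b c} → Hom b c → Hom a b → Hom a c
    unitᶜ : Obj
    _⊗₀_  : Obj → Obj → Obj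
    _⊗₁_  : ∀ {a b c d} → Hom a b → Hom c d → Hom (a ⊗₀ c) (b ⊗₀ d)

Op : MonCatData → MonCatData
Op C = record
  { Obj = Obj ; Hom = λ a b → Hom b a ; _≈_ = _≈_ ; idᶜ = idᶜ
  ; _∘ᶜ_ = λ g f → f ∘ᶜ g ; unitᶜ = unitᶜ ; _⊗₀_ = _⊗₀_ ; _⊗₁_ = _⊗₁_ }
  where open MonCatData C

record MonIso (C D : MonCatData) : Set where
  module C = MonCatData C
  module D = MonCatData D
  field
    F₀      : C.Obj → D.Obj
    F₁      : ∀ {a b} → C.Hom a b → D.Hom (F₀ a) (F₀ b)
    F-resp  : ∀ {a b} {f g : C.Hom a b} → f C.≈ g → F₁ f D.≈ F₁ g
    F-id    : ∀ {a} → F₁ (C.idᶜ {a}) D.≈ D.idᶜ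
    F-∘     : ∀ {a b c} (g : C.Hom b c) (f : C.Hom a b) →
              F₁ (g C.∘ᶜ f) D.≈ (F₁ g D.∘ᶜ F₁ f)
    F-unit  : F₀ C.unitᶜ ≡ D.unitᶜ
    F-⊗₀    : ∀ a b → F₀ (a C.⊗₀ b) ≡ F₀ a D.⊗₀ F₀ b
    F-⊗₁    : ∀ {a b c d} (f : C.Hom a b) (g : C.Hom c d) →
              subst₂ D.Hom (F-⊗₀ a c) (F-⊗₀ b d) (F₁ (f C.⊗₁ g)) D.≈ (F₁ f D.⊗₁ F₁ g)
    G₀      : D.Obj → C.Obj
    G₀F₀    : ∀ a → G₀ (F₀ a) ≡ a
    F₀G₀    : ∀ b → F₀ (G₀ b) ≡ b
    F-inj   : ∀ {a b} (f g : C.Hom a b) → F₁ f D.≈ F₁ g → f C.≈ g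
    F-surj  : ∀ {a b} (h : D.Hom (F₀ a) (F₀ b)) → Σ[ f ∈ C.Hom a b ] (F₁ f D.≈ h)

data Rule : Set where
  weakening exchange contraction : Rule

StructRules : Set
StructRules = Rule → Bool

Var : Set
Var = ℕ

module Language (Atom : Set) (S : StructRules) where

  Type : Set
  Type = List Atom

  -- raw terms: t ::= ∅ | x | t t  with associative tensor and unit ∅,
  -- i.e. the free monoid on variables (no functional constants)
  Term : Set
  Term = List Var

  Ctx : Set
  Ctx = List (Var × Atom)

  vars : Ctx → List Var
  vars = map proj₁

  types : Ctx → Type
  types = map proj₂

  lookupVar : List (Var × Var) → Var → Var
  lookupVar [] v = v
  lookupVar ((y , s) ∷ ρ) v with v ℕ.≟ y
  ... | yes _ = s
  ... | no  _ = lookupVar ρ v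

  _[_/_] : Term → Term → List Var → Term
  t [ s / y ] = map (lookupVar (zip y s)) t

  infix 4 _⊢_∶_
  data _⊢_∶_ : Ctx → Term → Type → Set where
    variable′ : ∀ x a → [ (x , a) ] ⊢ [ x ] ∶ [ a ]
    substitution : ∀ {Γ Δ s t C} →
      Γ ⊢ s ∶ types Δ → Δ ⊢ t ∶ C → Γ ⊢ t [ s / vars Δ ] ∶ C
    unit : [] ⊢ [] ∶ []
    tensor : ∀ {Γ Δ s t B D} →
      Γ ⊢ s ∶ B → Δ ⊢ t ∶ D → Unique (vars (Γ ++ᴸ Δ)) →
      Γ ++ᴸ Δ ⊢ s ++ᴸ t ∶ B ++ᴸ D
    weaken : ∀ {Γ₁ Γ₂ Γ₃ t B} → S weakening ≡ true →
      Γ₁ ++ᴸ Γ₃ ⊢ t ∶ B → Unique (vars (Γ₁ ++ᴸ Γ₂ ++ᴸ Γ₃)) →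
      Γ₁ ++ᴸ Γ₂ ++ᴸ Γ₃ ⊢ t ∶ B
    exchange : ∀ {Γ Δ t B} → S exchange ≡ true →
      Γ ⊢ t ∶ B → Γ ↭ Δ → Δ ⊢ t ∶ B
    contract : ∀ {Γ₁ X X′ Γ₂ t B} → S contraction ≡ true →
      types X ≡ types X′ →
      Γ₁ ++ᴸ X ++ᴸ X′ ++ᴸ Γ₂ ⊢ t ∶ B →
      Γ₁ ++ᴸ X ++ᴸ Γ₂ ⊢ t [ vars X / vars X′ ] ∶ B

  record LHom (A B : Type) : Set where
    constructor lhom
    field
      ctx     : Ctx
      ctxType : types ctx ≡ A
      term    : Term
      deriv   : ctx ⊢ term ∶ B
  open LHom

  -- alphabetical variance: s[z/x] = t[z/y] for some z : A
  _≈L_ : ∀ {A B} → LHom A B → LHom A B → Set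
  _≈L_ {A} f g = Σ[ z ∈ List Var ] (length z ≡ length A × Unique z ×
                   term f [ z / vars (ctx f) ] ≡ term g [ z / vars (ctx g) ])

  canon : ℕ → Type → Ctx
  canon k [] = []
  canon k (a ∷ A) = (k , a) ∷ canon (suc k) A

  canon-types : ∀ k A → types (canon k A) ≡ A
  canon-types k [] = refl
  canon-types k (a ∷ A) = cong (a ∷_) (canon-types (suc k) A)

  canon-≥ : ∀ {j} k A → j ≤ k → All (j ≤_) (vars (canon k A))
  canon-≥ k [] _ = []
  canon-≥ k (a ∷ A) le = le ∷ canon-≥ (suc k) A (≤-trans le (n≤1+n k))

  canon-unique : ∀ k A → Unique (vars (canon k A))
  canon-unique k [] = []
  canon-unique k (a ∷ A) =
    All.map (λ le eq → <-irrefl refl (subst (suc k ≤_) (sym eq) le))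
            (canon-≥ (suc k) A ≤-refl)
    ∷ canon-unique (suc k) A

  canon-++ : ∀ k A C → canon k A ++ᴸ canon (k + length A) C ≡ canon k (A ++ᴸ C)
  canon-++ k [] C = cong (λ n → canon n C) (+-identityʳ k)
  canon-++ k (a ∷ A) C =
    cong ((k , a) ∷_) (trans (cong (λ n → canon (suc k) A ++ᴸ canon n C) (+-suc k (length A)))
                             (canon-++ (suc k) A C))

  canon-id : ∀ k A → canon k A ⊢ vars (canon k A) ∶ A
  canon-id k [] = unit
  canon-id k (a ∷ A) =
    tensor (variable′ k a) (canon-id (suc k) A) (canon-unique k (a ∷ A))

  rename : ∀ {A B} → (k : ℕ) → (f : LHom A B) → canon k A ⊢ term f [ vars (canon k A) / vars (ctx f) ] ∶ B
  rename {A} k (lhom Γ refl t d) = substitution (canon-id k (types Γ)) d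

  idL : ∀ {A} → LHom A A
  idL {A} = lhom (canon 0 A) (canon-types 0 A) _ (canon-id 0 A)

  _∘L_ : ∀ {A B C} → LHom B C → LHom A B → LHom A C
  lhom Δ refl t e ∘L lhom Γ p s d = lhom Γ p _ (substitution d e)

  _⊗L_ : ∀ {A B C D} → LHom A B → LHom C D → LHom (A ++ᴸ C) (B ++ᴸ D)
  _⊗L_ {A} {B} {C} {D} f g =
    lhom (canon 0 (A ++ᴸ C)) (canon-types 0 (A ++ᴸ C)) t
      (subst (λ Γ → Γ ⊢ t ∶ B ++ᴸ D) (canon-++ 0 A C)
        (tensor (rename 0 f) (rename (0 + length A) g)
          (subst (λ Γ → Unique (vars Γ)) (sym (canon-++ 0 A C)) (canon-unique 0 (A ++ᴸ C)))))
    where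
    t = term f [ vars (canon 0 A) / vars (ctx f) ]
        ++ᴸ term g [ vars (canon (0 + length A) C) / vars (ctx g) ]

  TermCat : MonCatData
  TermCat = record
    { Obj = Type ; Hom = LHom ; _≈_ = _≈L_ ; idᶜ = idL ; _∘ᶜ_ = _∘L_
    ; unitᶜ = [] ; _⊗₀_ = _++ᴸ_ ; _⊗₁_ = _⊗L_ }

  _⊕_ : ∀ {n m n′ m′} → (Fin n → Fin m) → (Fin n′ → Fin m′) → Fin (n + n′) → Fin (m + m′)
  _⊕_ {n} {m} {n′} {m′} f g i = [ (λ j → f j ↑ˡ m′) , (λ j → m ↑ʳ g j) ]′ (splitAt n i)

  ∇ : ∀ {n} → Fin (n + n) → Fin n
  ∇ {n} i = [ id , id ]′ (splitAt n i)

  initial : ∀ {n} → Fin 0 → Fin n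
  initial ()

  -- arrows of the monoidal subcategory 𝐒 of 𝐊 generated by the chosen generators
  data InS : ∀ {n m} → (Fin n → Fin m) → Set where
    idS   : ∀ {n} → InS (id {A = Fin n})
    compS : ∀ {n m k} {g : Fin m → Fin k} {f : Fin n → Fin m} → InS g → InS f → InS (g ∘ f)
    sumS  : ∀ {n m n′ m′} {f : Fin n → Fin m} {g : Fin n′ → Fin m′} → InS f → InS g → InS (f ⊕ g)
    extS  : ∀ {n m} {f g : Fin n → Fin m} → (∀ i → f i ≡ g i) → InS f → InS g
    genW  : ∀ {n} → S weakening ≡ true → InS (initial {n})
    genE  : ∀ {n} → S exchange ≡ true → (σ τ : Fin n → Fin n) →
            (∀ i → σ (τ i) ≡ i) → (∀ i → τ (σ i) ≡ i) → InS σ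
    genC  : ∀ {n} → S contraction ≡ true → InS (∇ {n})

  -- objects of 𝐒/A: (n , T) with T : n → A (given as a vector)
  CObj : Set
  CObj = Σ ℕ (Vec Atom)

  record CHom (X Y : CObj) : Set where
    constructor chom
    field
      fun  : Fin (proj₁ X) → Fin (proj₁ Y)
      inS  : InS fun
      comm : ∀ i → lookup (proj₂ Y) (fun i) ≡ lookup (proj₂ X) i
  open CHom

  _≈C_ : ∀ {X Y} → CHom X Y → CHom X Y → Set
  f ≈C g = ∀ i → fun f i ≡ fun g i

  _⊗C_ : CObj → CObj → CObj
  (n , T) ⊗C (m , U) = (n + m , T ++ⱽ U)

  ⊕-comm : ∀ {n m n′ m′} (T : Vec Atom n) (T′ : Vec Atom m) (U : Vec Atom n′) (U′ : Vec Atom m′)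
    (f : Fin n → Fin m) (g : Fin n′ → Fin m′) →
    (∀ i → lookup T′ (f i) ≡ lookup T i) → (∀ i → lookup U′ (g i) ≡ lookup U i) →
    ∀ i → lookup (T′ ++ⱽ U′) ((f ⊕ g) i) ≡ lookup (T ++ⱽ U) i
  ⊕-comm {n} T T′ U U′ f g cf cg i
    rewrite lookup-splitAt n T U i with splitAt n i
  ... | inj₁ j = trans (lookup-++ˡ T′ U′ (f j)) (cf j)
  ... | inj₂ j = trans (lookup-++ʳ T′ U′ (g j)) (cg j)

  CommaCat : MonCatData
  CommaCat = record
    { Obj = CObj ; Hom = CHom ; _≈_ = _≈C_
    ; idᶜ = chom id idS (λ i → refl)
    ; _∘ᶜ_ = λ g f → chom (fun g ∘ fun f) (compS (inS g) (inS f))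
                         (λ i → trans (comm g (fun f i)) (comm f i))
    ; unitᶜ = (0 , []ⱽ) ; _⊗₀_ = _⊗C_
    ; _⊗₁_ = λ {(n , T)} {(m , T′)} {(n′ , U)} {(m′ , U′)} f g →
        chom (fun f ⊕ fun g) (sumS (inS f) (inS g))
             (⊕-comm T T′ U U′ (fun f) (fun g) (comm f) (comm g)) }

open Language public using (TermCat; CommaCat)

-- A purely structural term x : A ⊢ t : B is a list of variables of x, hence a reindexing
-- t = x ∘ φ, B = A ∘ φ of its context along a map φ : |B| → |A| of finite cardinals, i.e. an
-- arrow (|B|, B) → (|A|, A) of the comma category. Each rule of the calculus acts on these maps
-- as an operation of 𝐒 does: Substitution composes them, Tensor sums them, and Weakening,
-- Exchange and Contraction precompose an initial map, a permutation or a codiagonal. So φ lies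
-- in 𝐒, and conversely induction on 𝐒 realises every such arrow by a derivation on distinct
-- variables. Because the variables of a context are distinct, φ is recovered from t, and from any
-- renaming of t; this makes t ↦ φ a strict monoidal functor that is bijective on hom-sets, while
-- A ↦ (|A|, A) is bijective on objects.

module Submission where

open import Defs

open import Data.Bool using (true)
open import Data.Empty using (⊥-elim)
open import Data.Fin using (Fin; zero; suc; toℕ; cast; splitAt; _↑ˡ_; _↑ʳ_; punchIn)
open import Data.Fin.Permutation
  using (Permutation; Permutation′; permutation; _⟨$⟩ʳ_; _⟨$⟩ˡ_; inverseˡ; inverseʳ; remove;
         punchIn-permute; ↔⇒≡)
open import Data.Fin.Properties
  using (toℕ-injective; toℕ-cast; toℕ<n; toℕ-↑ˡ; toℕ-↑ʳ; splitAt⁻¹-↑ˡ; splitAt⁻¹-↑ʳ;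
         cast-is-id; cast-involutive)
open import Data.List using (List; []; _∷_; length; map; zip; tabulate; lookup) renaming (_++_ to _++ᴸ_)
open import Data.List.Properties
  using (length-map; length-++; length-tabulate; ++-assoc; ++-identityʳ; map-++; map-id; map-cong-local;
         tabulate-cong; tabulate-lookup)
open import Data.List.Membership.Propositional using (_∉_)
open import Data.List.Relation.Binary.Disjoint.Propositional using (Disjoint)
open import Data.List.Relation.Binary.Permutation.Propositional
  using (_↭_; prep; swap; ↭-sym; ↭⇒↭ₛ) renaming (refl to ↭-refl; trans to ↭-trans)
import Data.List.Relation.Binary.Permutation.Propositional.Properties as ↭
open import Data.List.Relation.Binary.Permutation.Setoid using (onIndices)
open import Data.List.Relation.Binary.Sublist.Propositional using (_⊆_; []; _∷_; _∷ʳ_; ⊆-refl)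
import Data.List.Relation.Binary.Sublist.Propositional.Properties as Sublist
open import Data.List.Relation.Unary.All as All using (All; []; _∷_)
import Data.List.Relation.Unary.All.Properties as All
open import Data.List.Relation.Unary.Any using (here; there)
open import Data.List.Relation.Unary.AllPairs using ([]; _∷_)
open import Data.List.Relation.Unary.Unique.Propositional using (Unique)
import Data.List.Relation.Unary.Unique.Propositional.Properties as Unique
open import Data.Maybe using (Maybe; just; nothing) renaming (map to mapᴹ)
open import Data.Maybe.Properties using (just-injective)
open import Data.Nat using (ℕ; zero; suc; _+_; _<_; s≤s)
import Data.Nat as ℕ
open import Data.Nat.Properties using (suc-injective; ≤-refl; ≤-trans; <⇒≱; m≤m+n; m≤n+m)
open import Data.Nat.ListAction using (sum)
open import Data.Product using (Σ; ∃; ∃₂; _×_; _,_; proj₁; proj₂)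
open import Data.Vec using (fromList; toList) renaming (lookup to lookupⱽ; [] to []ⱽ; _∷_ to _∷ⱽ_)
open import Data.Vec.Properties using (toList∘fromList)
open import Data.Sum using (inj₁; inj₂; [_,_]′)
open import Function using (id; _∘_)
open import Relation.Nullary using (yes; no)
open import Relation.Binary.PropositionalEquality
  using (_≡_; _≢_; refl; sym; trans; cong; cong₂; subst; subst₂; setoid; module ≡-Reasoning)

-- Indexing by ℕ rather than by Fin (length xs) compares lists of propositionally,
-- but not definitionally, equal lengths without casts.
infixl 20 _!_
_!_ : {X : Set} → List X → ℕ → Maybe X
[] ! n = nothing
(x ∷ xs) ! zero = just x
(x ∷ xs) ! suc n = xs ! n

module _ {X : Set} where

  !-map : ∀ {Y : Set} (f : X → Y) (xs : List X) n → map f xs ! n ≡ mapᴹ f (xs ! n)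
  !-map f [] n = refl
  !-map f (x ∷ xs) zero = refl
  !-map f (x ∷ xs) (suc n) = !-map f xs n

  !-++ˡ : ∀ (xs ys : List X) {n} → n < length xs → (xs ++ᴸ ys) ! n ≡ xs ! n
  !-++ˡ (x ∷ xs) ys {zero} _ = refl
  !-++ˡ (x ∷ xs) ys {suc n} (s≤s n<) = !-++ˡ xs ys n<

  !-++ʳ : ∀ (xs ys : List X) n → (xs ++ᴸ ys) ! (length xs + n) ≡ ys ! n
  !-++ʳ [] ys n = refl
  !-++ʳ (x ∷ xs) ys n = !-++ʳ xs ys n

  !-just : ∀ (xs : List X) {n} → n < length xs → ∃ λ v → xs ! n ≡ just v
  !-just (x ∷ xs) {zero} _ = x , refl
  !-just (x ∷ xs) {suc n} (s≤s n<) = !-just xs n<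

  !-lookup : ∀ (xs : List X) i → xs ! toℕ i ≡ just (lookup xs i)
  !-lookup (x ∷ xs) zero = refl
  !-lookup (x ∷ xs) (suc i) = !-lookup xs i

  !-fromList : ∀ (xs : List X) i → xs ! toℕ i ≡ just (lookupⱽ (fromList xs) i)
  !-fromList (x ∷ xs) zero = refl
  !-fromList (x ∷ xs) (suc i) = !-fromList xs i

  !-tabulate : ∀ {n} (v : Fin n → X) i → tabulate v ! toℕ i ≡ just (v i)
  !-tabulate v zero = refl
  !-tabulate v (suc i) = !-tabulate (v ∘ suc) i

  !-ext : ∀ {xs ys : List X} {n} → length xs ≡ n → length ys ≡ n →
          (∀ (i : Fin n) → xs ! toℕ i ≡ ys ! toℕ i) → xs ≡ ys
  !-ext {[]} {[]} _ _ _ = refl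
  !-ext {[]} {_ ∷ _} refl () _
  !-ext {_ ∷ _} {[]} refl () _
  !-ext {x ∷ xs} {y ∷ ys} {suc n} eqx eqy pointwise =
    cong₂ _∷_ (just-injective (pointwise zero))
              (!-ext (suc-injective eqx) (suc-injective eqy) (pointwise ∘ suc))

  !-∉ : ∀ {x : X} xs → All (x ≢_) xs → ∀ {n} → xs ! n ≢ just x
  !-∉ (y ∷ xs) (x≢y ∷ _) {zero} eq = x≢y (sym (just-injective eq))
  !-∉ (y ∷ xs) (_ ∷ x∉) {suc n} eq = !-∉ xs x∉ eq

  !-injective : ∀ {xs : List X} → Unique xs →
                ∀ {m n v} → xs ! m ≡ just v → xs ! n ≡ just v → m ≡ n
  !-injective {x ∷ xs} _ {zero} {zero} _ _ = refl
  !-injective {x ∷ xs} (x∉ ∷ _) {zero} {suc n} refl xs!n = ⊥-elim (!-∉ xs x∉ xs!n)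
  !-injective {x ∷ xs} (x∉ ∷ _) {suc m} {zero} xs!m refl = ⊥-elim (!-∉ xs x∉ xs!m)
  !-injective {x ∷ xs} (_ ∷ u) {suc m} {suc n} xs!m xs!n = cong suc (!-injective u xs!m xs!n)

  Unique-⊆ : ∀ {xs ys : List X} → xs ⊆ ys → Unique ys → Unique xs
  Unique-⊆ [] [] = []
  Unique-⊆ (_ ∷ʳ xs⊆ys) (_ ∷ u) = Unique-⊆ xs⊆ys u
  Unique-⊆ (refl ∷ xs⊆ys) (y∉ ∷ u) = Sublist.All-resp-⊆ xs⊆ys y∉ ∷ Unique-⊆ xs⊆ys u

  Unique-++⁻ : ∀ xs {ys : List X} → Unique (xs ++ᴸ ys) →
               Unique xs × Unique ys × Disjoint xs ys
  Unique-++⁻ [] u = [] , u , λ { (() , _) }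
  Unique-++⁻ (x ∷ xs) (x∉ ∷ u) with Unique-++⁻ xs u
  ... | uxs , uys , disjoint = All.++⁻ˡ xs x∉ ∷ uxs , uys , λ where
        (here refl , x∈ys) → All.lookup (All.++⁻ʳ xs x∉) x∈ys refl
        (there v∈xs , v∈ys) → disjoint (v∈xs , v∈ys)

  Unique-middle : ∀ xs {ys zs : List X} → Unique (xs ++ᴸ ys ++ᴸ zs) →
                  Unique ys × All (_∉ ys) (xs ++ᴸ zs)
  Unique-middle [] {ys} u with Unique-++⁻ ys u
  ... | uys , _ , disjoint = uys , All.tabulate (λ v∈zs v∈ys → disjoint (v∈ys , v∈zs))
  Unique-middle (x ∷ xs) {ys} (x∉ ∷ u) with Unique-middle xs u
  ... | uys , fresh = uys , (λ x∈ys → All.lookup (All.++⁻ˡ ys (All.++⁻ʳ xs x∉)) x∈ys refl) ∷ fresh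

  ++-split : ∀ m {m′} (xs : List X) → length xs ≡ m + m′ →
             ∃₂ λ ys zs → length ys ≡ m × length zs ≡ m′ × ys ++ᴸ zs ≡ xs
  ++-split zero xs eq = [] , xs , refl , eq , refl
  ++-split (suc m) (x ∷ xs) eq with ++-split m xs (suc-injective eq)
  ... | ys , zs , eqy , eqz , refl = x ∷ ys , zs , cong suc eqy , eqz , refl

  tabulate-punchIn : ∀ {n} (v : Fin (suc n) → X) i → v i ∷ tabulate (v ∘ punchIn i) ↭ tabulate v
  tabulate-punchIn v zero = ↭-refl
  tabulate-punchIn {suc n} v (suc i) =
    ↭-trans (swap _ _ ↭-refl) (prep (v zero) (tabulate-punchIn (v ∘ suc) i))

  tabulate-permute : ∀ {m n} (π : Permutation m n) (v : Fin n → X) →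
                     tabulate (v ∘ (π ⟨$⟩ʳ_)) ↭ tabulate v
  tabulate-permute {zero} {zero} π v = ↭-refl
  tabulate-permute {zero} {suc n} π v with () ← π ⟨$⟩ˡ zero
  tabulate-permute {suc m} {zero} π v with () ← π ⟨$⟩ʳ zero
  tabulate-permute {suc m} {suc n} π v =
    ↭-trans (prep (v p) (subst (_↭ tabulate (v ∘ punchIn p)) reorder
                               (tabulate-permute (remove zero π) (v ∘ punchIn p))))
            (tabulate-punchIn v p)
    where
    p = π ⟨$⟩ʳ zero
    reorder : tabulate (v ∘ punchIn p ∘ (remove zero π ⟨$⟩ʳ_)) ≡ tabulate (v ∘ (π ⟨$⟩ʳ_) ∘ suc)
    reorder = tabulate-cong (cong v ∘ sym ∘ punchIn-permute π zero)

-- Reindexing a list along a map of finite cardinals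

infix 4 _∘ᴸ_≐_
record _∘ᴸ_≐_ {X : Set} (xs : List X) {n m : ℕ} (φ : Fin n → Fin m) (ys : List X) : Set where
  field
    length≡ : length ys ≡ n
    lookup≡ : ∀ i → xs ! toℕ (φ i) ≡ ys ! toℕ i
open _∘ᴸ_≐_

module _ {X : Set} where

  ∘ᴸ-id : ∀ {xs : List X} {n} → length xs ≡ n → xs ∘ᴸ id {A = Fin n} ≐ xs
  ∘ᴸ-id eq = record { length≡ = eq ; lookup≡ = λ _ → refl }

  ∘ᴸ-cast : ∀ {xs : List X} {n n′} → length xs ≡ n → (e : n ≡ n′) → xs ∘ᴸ cast e ≐ xs
  ∘ᴸ-cast {xs} eq e = record { length≡ = eq ; lookup≡ = λ i → cong (xs !_) (toℕ-cast e i) }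

  ∘ᴸ-∘ : ∀ {xs ys zs : List X} {k n m} {φ : Fin n → Fin m} {ψ : Fin k → Fin n} →
         xs ∘ᴸ φ ≐ ys → ys ∘ᴸ ψ ≐ zs → xs ∘ᴸ φ ∘ ψ ≐ zs
  ∘ᴸ-∘ {ψ = ψ} r s = record
    { length≡ = length≡ s ; lookup≡ = λ i → trans (lookup≡ r (ψ i)) (lookup≡ s i) }

  ∘ᴸ-cong : ∀ {xs ys : List X} {n m m′} {φ : Fin n → Fin m} {ψ : Fin n → Fin m′} →
            (∀ i → toℕ (φ i) ≡ toℕ (ψ i)) → xs ∘ᴸ φ ≐ ys → xs ∘ᴸ ψ ≐ ys
  ∘ᴸ-cong {xs} φ≗ψ r = record
    { length≡ = length≡ r ; lookup≡ = λ i → trans (cong (xs !_) (sym (φ≗ψ i))) (lookup≡ r i) }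

  ∘ᴸ-functional : ∀ {xs ys zs : List X} {n m} {φ : Fin n → Fin m} →
                  xs ∘ᴸ φ ≐ ys → xs ∘ᴸ φ ≐ zs → ys ≡ zs
  ∘ᴸ-functional r s = !-ext (length≡ r) (length≡ s) (λ i → trans (sym (lookup≡ r i)) (lookup≡ s i))

  ∘ᴸ-injective : ∀ {xs ys : List X} {n m m′} {φ : Fin n → Fin m} {ψ : Fin n → Fin m′} →
                 Unique xs → xs ∘ᴸ φ ≐ ys → xs ∘ᴸ ψ ≐ ys → ∀ i → toℕ (φ i) ≡ toℕ (ψ i)
  ∘ᴸ-injective {ys = ys} u r s i with !-just ys (subst (toℕ i <_) (sym (length≡ r)) (toℕ<n i))
  ... | _ , ys!i = !-injective u (trans (lookup≡ r i) ys!i) (trans (lookup≡ s i) ys!i)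

  ∘ᴸ-map : ∀ {Y : Set} {xs ys : List X} {n m} {φ : Fin n → Fin m} (f : X → Y) →
           xs ∘ᴸ φ ≐ ys → map f xs ∘ᴸ φ ≐ map f ys
  ∘ᴸ-map {xs = xs} {ys} {φ = φ} f r = record
    { length≡ = trans (length-map f ys) (length≡ r)
    ; lookup≡ = λ i → trans (!-map f xs (toℕ (φ i)))
                      (trans (cong (mapᴹ f) (lookup≡ r i)) (sym (!-map f ys (toℕ i)))) }

  ∘ᴸ-↑ˡ : ∀ {as bs : List X} {m} n → length as ≡ m → as ++ᴸ bs ∘ᴸ (_↑ˡ n) ≐ as
  ∘ᴸ-↑ˡ {as} {bs} n eq = record
    { length≡ = eq
    ; lookup≡ = λ i → trans (cong ((as ++ᴸ bs) !_) (toℕ-↑ˡ i n))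
                            (!-++ˡ as bs (subst (toℕ i <_) (sym eq) (toℕ<n i))) }

  ∘ᴸ-↑ʳ : ∀ {as bs : List X} {m n} → length as ≡ m → length bs ≡ n → as ++ᴸ bs ∘ᴸ (m ↑ʳ_) ≐ bs
  ∘ᴸ-↑ʳ {as} {bs} {m} eqa eqb = record
    { length≡ = eqb
    ; lookup≡ = λ i → trans (cong ((as ++ᴸ bs) !_) (trans (toℕ-↑ʳ m i) (cong (_+ toℕ i) (sym eqa))))
                            (!-++ʳ as bs (toℕ i)) }

  ∘ᴸ-copair : ∀ {xs ys zs : List X} {n n′ m} {f : Fin n → Fin m} {g : Fin n′ → Fin m} →
              xs ∘ᴸ f ≐ ys → xs ∘ᴸ g ≐ zs → xs ∘ᴸ (λ i → [ f , g ]′ (splitAt n i)) ≐ ys ++ᴸ zs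
  ∘ᴸ-copair {xs} {ys} {zs} {n} {n′} {f = f} {g} r s = record
    { length≡ = trans (length-++ ys) (cong₂ _+_ (length≡ r) (length≡ s)) ; lookup≡ = pointwise }
    where
    open ≡-Reasoning
    pointwise : ∀ i → xs ! toℕ ([ f , g ]′ (splitAt n i)) ≡ (ys ++ᴸ zs) ! toℕ i
    pointwise i with splitAt n i in eq
    ... | inj₁ j = begin
      xs ! toℕ (f j)               ≡⟨ lookup≡ r j ⟩
      ys ! toℕ j                   ≡⟨ lookup≡ (∘ᴸ-↑ˡ {as = ys} {bs = zs} n′ (length≡ r)) j ⟨
      (ys ++ᴸ zs) ! toℕ (j ↑ˡ n′)  ≡⟨ cong (λ k → (ys ++ᴸ zs) ! toℕ k) (splitAt⁻¹-↑ˡ eq) ⟩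
      (ys ++ᴸ zs) ! toℕ i          ∎
    ... | inj₂ j = begin
      xs ! toℕ (g j)               ≡⟨ lookup≡ s j ⟩
      zs ! toℕ j                   ≡⟨ lookup≡ (∘ᴸ-↑ʳ {as = ys} {bs = zs} (length≡ r) (length≡ s)) j ⟨
      (ys ++ᴸ zs) ! toℕ (n ↑ʳ j)   ≡⟨ cong (λ k → (ys ++ᴸ zs) ! toℕ k) (splitAt⁻¹-↑ʳ eq) ⟩
      (ys ++ᴸ zs) ! toℕ i          ∎

module TermCategory (Atom : Set) (S : StructRules) where

  open import Data.List.Relation.Binary.Permutation.Setoid.Properties (setoid (Var × Atom))
    using (onIndices-lookup)
  open import Data.List.Relation.Binary.Permutation.Setoid.Properties (setoid Var)
    using (Unique-resp-↭)

  open Language Atom S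

  module _ {X : Set} where

    ∘ᴸ-⊕ : ∀ {xs xs′ ys ys′ : List X} {n m n′ m′} {f : Fin n → Fin m} {g : Fin n′ → Fin m′} →
           length xs ≡ m → length xs′ ≡ m′ → xs ∘ᴸ f ≐ ys → xs′ ∘ᴸ g ≐ ys′ →
           xs ++ᴸ xs′ ∘ᴸ f ⊕ g ≐ ys ++ᴸ ys′
    ∘ᴸ-⊕ {xs} {xs′} {m = m} {m′ = m′} {f = f} {g} eq eq′ r r′ =
      ∘ᴸ-copair {f = λ j → f j ↑ˡ m′} {g = λ j → m ↑ʳ g j}
                (∘ᴸ-∘ (∘ᴸ-↑ˡ {as = xs} {bs = xs′} m′ eq) r)
                (∘ᴸ-∘ (∘ᴸ-↑ʳ {as = xs} {bs = xs′} eq eq′) r′)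

    ∘ᴸ-∇ : ∀ {xs : List X} {n} → length xs ≡ n → xs ∘ᴸ ∇ {n} ≐ xs ++ᴸ xs
    ∘ᴸ-∇ eq = ∘ᴸ-copair {f = id} {g = id} (∘ᴸ-id eq) (∘ᴸ-id eq)

    ∘ᴸ-initial : ∀ {xs : List X} {n} → xs ∘ᴸ initial {n} ≐ []
    ∘ᴸ-initial = record { length≡ = refl ; lookup≡ = λ () }

    ∘ᴸ-recast : ∀ {xs ys : List X} {n m n′ m′} {f : Fin n → Fin m} (p : n′ ≡ n) (q : m ≡ m′) →
                length xs ≡ m′ → xs ∘ᴸ f ≐ ys → xs ∘ᴸ cast q ∘ f ∘ cast p ≐ ys
    ∘ᴸ-recast p q eq r =
      ∘ᴸ-∘ (∘ᴸ-∘ (∘ᴸ-cast (trans eq (sym q)) q) r) (∘ᴸ-cast (trans (length≡ r) (sym p)) p)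

  cast∈S : ∀ {n m} (e : n ≡ m) → InS (cast e)
  cast∈S refl = extS (λ i → sym (cast-is-id refl i)) idS

  recast∈S : ∀ {n m n′ m′} {f : Fin n → Fin m} (p : n′ ≡ n) (q : m ≡ m′) →
             InS f → InS (cast q ∘ f ∘ cast p)
  recast∈S p q f∈S = compS (compS (cast∈S q) f∈S) (cast∈S p)

  permutation∈S : S exchange ≡ true → ∀ {m n} (π : Permutation m n) → InS (π ⟨$⟩ʳ_)
  permutation∈S x π with refl ← ↔⇒≡ π =
    genE x (π ⟨$⟩ʳ_) (π ⟨$⟩ˡ_) (λ _ → inverseʳ π) (λ _ → inverseˡ π)

  -- Substitution

  lookupVar-fresh : ∀ {ys s : List Var} {v} → v ∉ ys → lookupVar (zip ys s) v ≡ v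
  lookupVar-fresh {[]} _ = refl
  lookupVar-fresh {y ∷ ys} {[]} _ = refl
  lookupVar-fresh {y ∷ ys} {_ ∷ s} {v} v∉ with v ℕ.≟ y
  ... | yes v≡y = ⊥-elim (v∉ (here v≡y))
  ... | no _ = lookupVar-fresh (v∉ ∘ there)

  substitute-fresh : ∀ {t ys s : List Var} → All (_∉ ys) t → t [ s / ys ] ≡ t
  substitute-fresh {t} fresh = trans (map-cong-local (All.map lookupVar-fresh fresh)) (map-id t)

  substitute-self : ∀ {ys s : List Var} → Unique ys → length ys ≡ length s → ys [ s / ys ] ≡ s
  substitute-self {[]} {[]} _ _ = refl
  substitute-self {y ∷ ys} {s₀ ∷ s} (y∉ ∷ u) eq =
    cong₂ _∷_ hit (trans skip (substitute-self u (suc-injective eq)))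
    where
    hit : lookupVar ((y , s₀) ∷ zip ys s) y ≡ s₀
    hit with y ℕ.≟ y
    ... | yes _ = refl
    ... | no y≢y = ⊥-elim (y≢y refl)
    skip : map (lookupVar ((y , s₀) ∷ zip ys s)) ys ≡ map (lookupVar (zip ys s)) ys
    skip = map-cong-local (All.map miss y∉)
      where
      miss : ∀ {v} → y ≢ v → lookupVar ((y , s₀) ∷ zip ys s) v ≡ lookupVar (zip ys s) v
      miss {v} y≢v with v ℕ.≟ y
      ... | yes v≡y = ⊥-elim (y≢v (sym v≡y))
      ... | no _ = refl

  substitute-middle : ∀ xs {ys zs s : List Var} → Unique (xs ++ᴸ ys ++ᴸ zs) →
                      length ys ≡ length s → (xs ++ᴸ ys ++ᴸ zs) [ s / ys ] ≡ xs ++ᴸ s ++ᴸ zs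
  substitute-middle xs {ys} {zs} {s} u eq with Unique-middle xs {ys} {zs} u
  ... | uys , fresh with All.++⁻ xs fresh
  ...   | freshxs , freshzs = begin
    map ρ (xs ++ᴸ ys ++ᴸ zs)               ≡⟨ map-++ ρ xs (ys ++ᴸ zs) ⟩
    map ρ xs ++ᴸ map ρ (ys ++ᴸ zs)         ≡⟨ cong (map ρ xs ++ᴸ_) (map-++ ρ ys zs) ⟩
    map ρ xs ++ᴸ map ρ ys ++ᴸ map ρ zs     ≡⟨ cong₂ _++ᴸ_ (substitute-fresh {ys = ys} freshxs)
                                                 (cong₂ _++ᴸ_ (substitute-self uys eq)
                                                              (substitute-fresh {ys = ys} freshzs)) ⟩
    xs ++ᴸ s ++ᴸ zs                        ∎
    where
    open ≡-Reasoning
    ρ = lookupVar (zip ys s)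

  ∘ᴸ-substitute : ∀ {ys s t : List Var} {n m} {φ : Fin n → Fin m} →
                  Unique ys → length ys ≡ length s → ys ∘ᴸ φ ≐ t → s ∘ᴸ φ ≐ t [ s / ys ]
  ∘ᴸ-substitute {ys} {s} {t} {φ = φ} u eq r =
    subst (_∘ᴸ φ ≐ t [ s / ys ]) (substitute-self u eq) (∘ᴸ-map (lookupVar (zip ys s)) r)

  -- Derivations determine arrows of 𝐒

  infix 4 _∘ᶜ_≐_∶_
  record _∘ᶜ_≐_∶_ (Γ : Ctx) {n m} (φ : Fin n → Fin m) (t : Term) (B : Type) : Set where
    constructor _,_
    field
      vars≐  : vars Γ ∘ᴸ φ ≐ t
      types≐ : types Γ ∘ᴸ φ ≐ B
  open _∘ᶜ_≐_∶_

  ∘ᶜ-id : ∀ {Γ n} → length Γ ≡ n → Γ ∘ᶜ id {A = Fin n} ≐ vars Γ ∶ types Γ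
  ∘ᶜ-id {Γ} eq = ∘ᴸ-id (trans (length-map proj₁ Γ) eq) , ∘ᴸ-id (trans (length-map proj₂ Γ) eq)

  ∘ᶜ-∘ : ∀ {Δ s A t B k n m} {c : Fin n → Fin m} {φ : Fin k → Fin n} →
         Δ ∘ᶜ c ≐ s ∶ A → s ∘ᴸ φ ≐ t → A ∘ᴸ φ ≐ B → Δ ∘ᶜ c ∘ φ ≐ t ∶ B
  ∘ᶜ-∘ (vs , ts) s∘φ A∘φ = ∘ᴸ-∘ vs s∘φ , ∘ᴸ-∘ ts A∘φ

  ∘ᶜ-cong : ∀ {Γ t B n m m′} {φ : Fin n → Fin m} {ψ : Fin n → Fin m′} →
            (∀ i → toℕ (φ i) ≡ toℕ (ψ i)) → Γ ∘ᶜ φ ≐ t ∶ B → Γ ∘ᶜ ψ ≐ t ∶ B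
  ∘ᶜ-cong φ≗ψ (vs , ts) = ∘ᴸ-cong φ≗ψ vs , ∘ᴸ-cong φ≗ψ ts

  ∘ᶜ-recast : ∀ {Γ t B n m n′ m′} {φ : Fin n → Fin m} (p : n′ ≡ n) (q : m ≡ m′) →
              length Γ ≡ m′ → Γ ∘ᶜ φ ≐ t ∶ B → Γ ∘ᶜ cast q ∘ φ ∘ cast p ≐ t ∶ B
  ∘ᶜ-recast {Γ} p q eq (vs , ts) =
    ∘ᴸ-recast p q (trans (length-map proj₁ Γ) eq) vs , ∘ᴸ-recast p q (trans (length-map proj₂ Γ) eq) ts

  ∘ᶜ-⊕ : ∀ {Γ Δ s t B D n m n′ m′} {φ : Fin n → Fin m} {ψ : Fin n′ → Fin m′} →
         length Γ ≡ m → length Δ ≡ m′ → Γ ∘ᶜ φ ≐ s ∶ B → Δ ∘ᶜ ψ ≐ t ∶ D →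
         Γ ++ᴸ Δ ∘ᶜ φ ⊕ ψ ≐ s ++ᴸ t ∶ B ++ᴸ D
  ∘ᶜ-⊕ {Γ} {Δ} {s} {t} {B} {D} {φ = φ} {ψ} eqΓ eqΔ (vs , ts) (vs′ , ts′) =
    subst (_∘ᴸ φ ⊕ ψ ≐ s ++ᴸ t) (sym (map-++ proj₁ Γ Δ))
          (∘ᴸ-⊕ (trans (length-map proj₁ Γ) eqΓ) (trans (length-map proj₁ Δ) eqΔ) vs vs′) ,
    subst (_∘ᴸ φ ⊕ ψ ≐ B ++ᴸ D) (sym (map-++ proj₂ Γ Δ))
          (∘ᴸ-⊕ (trans (length-map proj₂ Γ) eqΓ) (trans (length-map proj₂ Δ) eqΔ) ts ts′)

  ∘ᶜ-substitute : ∀ {Γ Δ s t C k m n m′} {φ : Fin n → Fin m} {ψ : Fin k → Fin m′} (e : m′ ≡ n) →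
                  Unique (vars Δ) → Γ ∘ᶜ φ ≐ s ∶ types Δ → Δ ∘ᶜ ψ ≐ t ∶ C →
                  Γ ∘ᶜ φ ∘ cast e ∘ ψ ≐ t [ s / vars Δ ] ∶ C
  ∘ᶜ-substitute {Δ = Δ} {s} e u (vs , ts) (vs′ , ts′) =
    ∘ᶜ-∘ (vs , ts) (∘ᴸ-∘ (∘ᴸ-cast (trans (length≡ vs) (sym e)) e)
                         (∘ᴸ-substitute u length-vars≡ vs′))
                   (∘ᴸ-∘ (∘ᴸ-cast (trans (length≡ ts) (sym e)) e) ts′)
    where
    length-vars≡ : length (vars Δ) ≡ length s
    length-vars≡ = trans (length-map proj₁ Δ)
                         (trans (sym (length-map proj₂ Δ)) (trans (length≡ ts) (sym (length≡ vs))))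

  ⊢-unique : ∀ {Γ t B} → Γ ⊢ t ∶ B → Unique (vars Γ)
  ⊢-unique (variable′ x a) = [] ∷ []
  ⊢-unique (substitution d e) = ⊢-unique d
  ⊢-unique unit = []
  ⊢-unique (tensor d e u) = u
  ⊢-unique (weaken _ d u) = u
  ⊢-unique (exchange _ d Γ↭Δ) = Unique-resp-↭ (↭⇒↭ₛ (↭.map⁺ proj₁ Γ↭Δ)) (⊢-unique d)
  ⊢-unique (contract {Γ₁} {X} {X′} {Γ₂} _ _ d) = Unique-⊆ (Sublist.map⁺ proj₁ new⊆old) (⊢-unique d)
    where
    new⊆old : Γ₁ ++ᴸ X ++ᴸ Γ₂ ⊆ Γ₁ ++ᴸ X ++ᴸ X′ ++ᴸ Γ₂
    new⊆old = Sublist.++⁺ (⊆-refl {x = Γ₁})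
                          (Sublist.++⁺ (⊆-refl {x = X}) (Sublist.++⁺ˡ X′ (⊆-refl {x = Γ₂})))

  infix 4 _⇒ˢ_
  record _⇒ˢ_ (Γ Δ : Ctx) : Set where
    constructor ⇒ˢ-intro
    field
      arrow   : Fin (length Γ) → Fin (length Δ)
      arrow∈S : InS arrow
      reindex : Δ ∘ᴸ arrow ≐ Γ

  weakening⇒ˢ : S weakening ≡ true → ∀ Γ₁ Γ₂ Γ₃ → Γ₁ ++ᴸ Γ₃ ⇒ˢ Γ₁ ++ᴸ Γ₂ ++ᴸ Γ₃
  weakening⇒ˢ w Γ₁ Γ₂ Γ₃ =
    ⇒ˢ-intro (cast q ∘ f ∘ cast p) (recast∈S {f = f} p q f∈S) (∘ᴸ-recast {f = f} p q refl new∘f)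
    where
    n₁ = length Γ₁ ; n₂ = length Γ₂ ; n₃ = length Γ₃
    f : Fin (n₁ + (0 + n₃)) → Fin (n₁ + (n₂ + n₃))
    f = id {A = Fin n₁} ⊕ (initial {n₂} ⊕ id {A = Fin n₃})
    f∈S : InS f
    f∈S = sumS (idS {n₁}) (sumS (genW {n₂} w) (idS {n₃}))
    new∘f : Γ₁ ++ᴸ Γ₂ ++ᴸ Γ₃ ∘ᴸ f ≐ Γ₁ ++ᴸ Γ₃
    new∘f = ∘ᴸ-⊕ {xs = Γ₁} {xs′ = Γ₂ ++ᴸ Γ₃} refl (length-++ Γ₂) (∘ᴸ-id refl)
                 (∘ᴸ-⊕ {xs = Γ₂} {xs′ = Γ₃} refl refl ∘ᴸ-initial (∘ᴸ-id refl))
    p : length (Γ₁ ++ᴸ Γ₃) ≡ n₁ + (0 + n₃)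
    p = length-++ Γ₁
    q : n₁ + (n₂ + n₃) ≡ length (Γ₁ ++ᴸ Γ₂ ++ᴸ Γ₃)
    q = sym (trans (length-++ Γ₁) (cong (n₁ +_) (length-++ Γ₂)))

  exchange⇒ˢ : S exchange ≡ true → ∀ {Γ Δ} → Γ ↭ Δ → Γ ⇒ˢ Δ
  exchange⇒ˢ x {Γ} {Δ} Γ↭Δ =
    ⇒ˢ-intro (π ⟨$⟩ʳ_) (permutation∈S x π) (record { length≡ = refl ; lookup≡ = lookup≡π })
    where
    π : Permutation (length Γ) (length Δ)
    π = onIndices (↭⇒↭ₛ Γ↭Δ)
    lookup≡π : ∀ i → Δ ! toℕ (π ⟨$⟩ʳ i) ≡ Γ ! toℕ i
    lookup≡π i = trans (!-lookup Δ _)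
                       (trans (cong just (sym (onIndices-lookup (↭⇒↭ₛ Γ↭Δ) i))) (sym (!-lookup Γ i)))

  record StructuralMap (Γ : Ctx) (t : Term) (B : Type) : Set where
    constructor structuralMap
    field
      arrow   : Fin (length B) → Fin (length Γ)
      arrow∈S : InS arrow
      reads   : Γ ∘ᶜ arrow ≐ t ∶ B

  along : ∀ {Γ Δ t B} → Γ ⇒ˢ Δ → StructuralMap Γ t B → StructuralMap Δ t B
  along (⇒ˢ-intro c c∈S Δ∘c) (structuralMap φ φ∈S (vs , ts)) =
    structuralMap (c ∘ φ) (compS c∈S φ∈S) (∘ᶜ-∘ (∘ᴸ-map proj₁ Δ∘c , ∘ᴸ-map proj₂ Δ∘c) vs ts)

  StructuralMap-substitution : ∀ {Γ Δ s t C} → Unique (vars Δ) →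
    StructuralMap Γ s (types Δ) → StructuralMap Δ t C → StructuralMap Γ (t [ s / vars Δ ]) C
  StructuralMap-substitution {Δ = Δ} u (structuralMap φ φ∈S Γ∘φ) (structuralMap ψ ψ∈S Δ∘ψ) =
    structuralMap (φ ∘ cast e ∘ ψ) (compS φ∈S (compS (cast∈S e) ψ∈S)) (∘ᶜ-substitute e u Γ∘φ Δ∘ψ)
    where
    e : length Δ ≡ length (types Δ)
    e = sym (length-map proj₂ Δ)

  StructuralMap-tensor : ∀ {Γ Δ s t B D} →
    StructuralMap Γ s B → StructuralMap Δ t D → StructuralMap (Γ ++ᴸ Δ) (s ++ᴸ t) (B ++ᴸ D)
  StructuralMap-tensor {Γ} {Δ} {B = B} {D} (structuralMap φ φ∈S Γ∘φ) (structuralMap ψ ψ∈S Δ∘ψ) =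
    structuralMap (cast q ∘ φ ⊕ ψ ∘ cast p) (recast∈S p q (sumS φ∈S ψ∈S))
                  (∘ᶜ-recast p q refl (∘ᶜ-⊕ refl refl Γ∘φ Δ∘ψ))
    where
    p : length (B ++ᴸ D) ≡ length B + length D
    p = length-++ B
    q : length Γ + length Δ ≡ length (Γ ++ᴸ Δ)
    q = sym (length-++ Γ)

  length-types : ∀ {Γ A} → types Γ ≡ A → length Γ ≡ length A
  length-types {Γ} eq = trans (sym (length-map proj₂ Γ)) (cong length eq)

  map-regroup : ∀ {Y : Set} (f : Var × Atom → Y) Γ₁ X Z Γ₂ →
                map f (Γ₁ ++ᴸ X ++ᴸ Z ++ᴸ Γ₂) ≡ map f (Γ₁ ++ᴸ X) ++ᴸ map f Z ++ᴸ map f Γ₂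
  map-regroup f Γ₁ X Z Γ₂ = begin
    map f (Γ₁ ++ᴸ X ++ᴸ Z ++ᴸ Γ₂)              ≡⟨ cong (map f) (++-assoc Γ₁ X (Z ++ᴸ Γ₂)) ⟨
    map f ((Γ₁ ++ᴸ X) ++ᴸ Z ++ᴸ Γ₂)            ≡⟨ map-++ f (Γ₁ ++ᴸ X) (Z ++ᴸ Γ₂) ⟩
    map f (Γ₁ ++ᴸ X) ++ᴸ map f (Z ++ᴸ Γ₂)      ≡⟨ cong (map f (Γ₁ ++ᴸ X) ++ᴸ_) (map-++ f Z Γ₂) ⟩
    map f (Γ₁ ++ᴸ X) ++ᴸ map f Z ++ᴸ map f Γ₂  ∎
    where open ≡-Reasoning

  map-regroup-doubled : ∀ {Y : Set} (f : Var × Atom → Y) Γ₁ X Γ₂ →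
                        map f (Γ₁ ++ᴸ (X ++ᴸ X) ++ᴸ Γ₂) ≡ map f (Γ₁ ++ᴸ X) ++ᴸ map f X ++ᴸ map f Γ₂
  map-regroup-doubled f Γ₁ X Γ₂ =
    trans (cong (map f ∘ (Γ₁ ++ᴸ_)) (++-assoc X X Γ₂)) (map-regroup f Γ₁ X X Γ₂)

  contraction-types : ∀ Γ₁ X X′ Γ₂ → types X ≡ types X′ →
                      types (Γ₁ ++ᴸ (X ++ᴸ X) ++ᴸ Γ₂) ≡ types (Γ₁ ++ᴸ X ++ᴸ X′ ++ᴸ Γ₂)
  contraction-types Γ₁ X X′ Γ₂ X≡X′ =
    trans (map-regroup-doubled proj₂ Γ₁ X Γ₂)
          (trans (cong (λ T → types (Γ₁ ++ᴸ X) ++ᴸ T ++ᴸ types Γ₂) X≡X′)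
                 (sym (map-regroup proj₂ Γ₁ X X′ Γ₂)))

  contraction-vars : ∀ Γ₁ X X′ Γ₂ → length X′ ≡ length X →
                     Unique (vars (Γ₁ ++ᴸ X ++ᴸ X′ ++ᴸ Γ₂)) →
                     vars (Γ₁ ++ᴸ (X ++ᴸ X) ++ᴸ Γ₂) ≡ vars (Γ₁ ++ᴸ X ++ᴸ X′ ++ᴸ Γ₂) [ vars X / vars X′ ]
  contraction-vars Γ₁ X X′ Γ₂ |X′|≡|X| u = begin
    vars (Γ₁ ++ᴸ (X ++ᴸ X) ++ᴸ Γ₂)
      ≡⟨ map-regroup-doubled proj₁ Γ₁ X Γ₂ ⟩
    vars Γ₁X ++ᴸ vars X ++ᴸ vars Γ₂
      ≡⟨ substitute-middle (vars Γ₁X) {vars X′} {vars Γ₂} u′ lengths≡ ⟨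
    (vars Γ₁X ++ᴸ vars X′ ++ᴸ vars Γ₂) [ vars X / vars X′ ]
      ≡⟨ cong (_[ vars X / vars X′ ]) (map-regroup proj₁ Γ₁ X X′ Γ₂) ⟨
    vars (Γ₁ ++ᴸ X ++ᴸ X′ ++ᴸ Γ₂) [ vars X / vars X′ ]
      ∎
    where
    open ≡-Reasoning
    Γ₁X = Γ₁ ++ᴸ X
    u′ : Unique (vars Γ₁X ++ᴸ vars X′ ++ᴸ vars Γ₂)
    u′ = subst Unique (map-regroup proj₁ Γ₁ X X′ Γ₂) u
    lengths≡ : length (vars X′) ≡ length (vars X)
    lengths≡ = trans (length-map proj₁ X′) (trans |X′|≡|X| (sym (length-map proj₁ X)))

  StructuralMap-contraction : S contraction ≡ true → ∀ Γ₁ X X′ Γ₂ {t B} → types X ≡ types X′ →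
    Unique (vars (Γ₁ ++ᴸ X ++ᴸ X′ ++ᴸ Γ₂)) → StructuralMap (Γ₁ ++ᴸ X ++ᴸ X′ ++ᴸ Γ₂) t B →
    StructuralMap (Γ₁ ++ᴸ X ++ᴸ Γ₂) (t [ vars X / vars X′ ]) B
  StructuralMap-contraction c Γ₁ X X′ Γ₂ X≡X′ u (structuralMap φ φ∈S (vs , ts)) =
    structuralMap (κ ∘ φ) (compS (recast∈S {f = f} p q f∈S) φ∈S)
                  (∘ᶜ-∘ new∘κ (∘ᴸ-map (lookupVar (zip (vars X′) (vars X))) vs) ts)
    where
    n₁ = length Γ₁ ; nX = length X ; n₂ = length Γ₂
    old = Γ₁ ++ᴸ X ++ᴸ X′ ++ᴸ Γ₂
    new = Γ₁ ++ᴸ X ++ᴸ Γ₂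
    f : Fin (n₁ + ((nX + nX) + n₂)) → Fin (n₁ + (nX + n₂))
    f = id {A = Fin n₁} ⊕ (∇ {nX} ⊕ id {A = Fin n₂})
    f∈S : InS f
    f∈S = sumS (idS {n₁}) (sumS (genC {nX} c) (idS {n₂}))
    new∘f : new ∘ᴸ f ≐ Γ₁ ++ᴸ (X ++ᴸ X) ++ᴸ Γ₂
    new∘f = ∘ᴸ-⊕ {xs = Γ₁} {xs′ = X ++ᴸ Γ₂} refl (length-++ X) (∘ᴸ-id refl)
                 (∘ᴸ-⊕ {xs = X} {xs′ = Γ₂} refl refl (∘ᴸ-∇ refl) (∘ᴸ-id refl))
    types≡ : types (Γ₁ ++ᴸ (X ++ᴸ X) ++ᴸ Γ₂) ≡ types old
    types≡ = contraction-types Γ₁ X X′ Γ₂ X≡X′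
    p : length old ≡ n₁ + ((nX + nX) + n₂)
    p = trans (length-types (sym types≡))
              (trans (length-map proj₂ (Γ₁ ++ᴸ (X ++ᴸ X) ++ᴸ Γ₂)) (length≡ new∘f))
    q : n₁ + (nX + n₂) ≡ length new
    q = sym (trans (length-++ Γ₁) (cong (n₁ +_) (length-++ X)))
    κ : Fin (length old) → Fin (length new)
    κ = cast q ∘ f ∘ cast p
    new∘κ : new ∘ᶜ κ ≐ vars old [ vars X / vars X′ ] ∶ types old
    new∘κ = subst₂ (new ∘ᶜ κ ≐_∶_)
                   (contraction-vars Γ₁ X X′ Γ₂ (trans (length-types (sym X≡X′)) (length-map proj₂ X)) u)
                   types≡
                   (∘ᶜ-recast p q refl (∘ᴸ-map proj₁ new∘f , ∘ᴸ-map proj₂ new∘f))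

  ⊢-structuralMap : ∀ {Γ t B} → Γ ⊢ t ∶ B → StructuralMap Γ t B
  ⊢-structuralMap (variable′ x a) = structuralMap id idS (∘ᶜ-id refl)
  ⊢-structuralMap (substitution d e) =
    StructuralMap-substitution (⊢-unique e) (⊢-structuralMap d) (⊢-structuralMap e)
  ⊢-structuralMap unit = structuralMap id idS (∘ᶜ-id refl)
  ⊢-structuralMap (tensor d e _) = StructuralMap-tensor (⊢-structuralMap d) (⊢-structuralMap e)
  ⊢-structuralMap (weaken {Γ₁} {Γ₂} {Γ₃} w d _) = along (weakening⇒ˢ w Γ₁ Γ₂ Γ₃) (⊢-structuralMap d)
  ⊢-structuralMap (exchange x d Γ↭Δ) = along (exchange⇒ˢ x Γ↭Δ) (⊢-structuralMap d)
  ⊢-structuralMap (contract {Γ₁} {X} {X′} {Γ₂} c X≡X′ d) =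
    StructuralMap-contraction c Γ₁ X X′ Γ₂ X≡X′ (⊢-unique d) (⊢-structuralMap d)

  -- Arrows of 𝐒 are realised by derivations

  record Realisation (Γ : Ctx) {n m} (φ : Fin n → Fin m) : Set where
    constructor realisation
    field
      {term}     : Term
      {type}     : Type
      derivation : Γ ⊢ term ∶ type
      reads      : Γ ∘ᶜ φ ≐ term ∶ type

  ⊢-identity : ∀ Γ → Unique (vars Γ) → Γ ⊢ vars Γ ∶ types Γ
  ⊢-identity [] _ = unit
  ⊢-identity ((x , a) ∷ Γ) u@(_ ∷ uΓ) = tensor (variable′ x a) (⊢-identity Γ uΓ) u

  length-canon : ∀ k A → length (canon k A) ≡ length A
  length-canon k A = trans (sym (length-map proj₂ (canon k A))) (cong length (canon-types k A))

  realise-⊕ : ∀ {Γ Δ n m n′ m′} {f : Fin n → Fin m} {g : Fin n′ → Fin m′} →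
              Unique (vars (Γ ++ᴸ Δ)) → length Γ ≡ m → length Δ ≡ m′ →
              Realisation Γ f → Realisation Δ g → Realisation (Γ ++ᴸ Δ) (f ⊕ g)
  realise-⊕ u eqΓ eqΔ (realisation d Γ∘f) (realisation e Δ∘g) =
    realisation (tensor d e u) (∘ᶜ-⊕ eqΓ eqΔ Γ∘f Δ∘g)

  realise-permutation : S exchange ≡ true → ∀ Γ → Unique (vars Γ) →
                        (π : Permutation′ (length Γ)) → Realisation Γ (π ⟨$⟩ʳ_)
  realise-permutation x Γ u π =
    realisation (exchange x (⊢-identity Γ′ u′) Γ′↭Γ) (∘ᴸ-map proj₁ Γ∘π , ∘ᴸ-map proj₂ Γ∘π)
    where
    Γ′ = tabulate (lookup Γ ∘ (π ⟨$⟩ʳ_))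
    Γ′↭Γ : Γ′ ↭ Γ
    Γ′↭Γ = subst (Γ′ ↭_) (tabulate-lookup Γ) (tabulate-permute π (lookup Γ))
    u′ : Unique (vars Γ′)
    u′ = Unique-resp-↭ (↭⇒↭ₛ (↭.map⁺ proj₁ (↭-sym Γ′↭Γ))) u
    Γ∘π : Γ ∘ᴸ (π ⟨$⟩ʳ_) ≐ Γ′
    Γ∘π = record
      { length≡ = length-tabulate _ ; lookup≡ = λ i → trans (!-lookup Γ _) (sym (!-tabulate _ i)) }

  <-suc-sum : ∀ (xs : List ℕ) → All (_< suc (sum xs)) xs
  <-suc-sum [] = []
  <-suc-sum (x ∷ xs) =
    s≤s (m≤m+n x (sum xs)) ∷ All.map (λ v< → ≤-trans v< (s≤s (m≤n+m (sum xs) x))) (<-suc-sum xs)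

  -- Γ′ is a copy of Γ on variables beyond all those of Γ; Contraction then identifies it with Γ.
  realise-contraction : S contraction ≡ true → ∀ Γ {m} → Unique (vars Γ) → length Γ ≡ m →
                        Realisation Γ (∇ {m})
  realise-contraction c Γ u eq =
    realisation (subst (_⊢ term ∶ types Γ ++ᴸ types Γ) (++-identityʳ Γ)
                   (contract {[]} {Γ} {Γ′} {[]} c (sym (canon-types K (types Γ))) pair))
                (subst (_ ∘ᴸ ∇ ≐_) (sym term≡) (∘ᴸ-∇ (trans (length-map proj₁ Γ) eq)) ,
                 ∘ᴸ-∇ (trans (length-map proj₂ Γ) eq))
    where
    K = suc (sum (vars Γ))
    Γ′ = canon K (types Γ)
    fresh : All (_∉ vars Γ′) (vars Γ)
    fresh = All.map (λ v<K v∈Γ′ → <⇒≱ v<K (All.lookup (canon-≥ K (types Γ) ≤-refl) v∈Γ′))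
                    (<-suc-sum (vars Γ))
    unique : Unique (vars (Γ ++ᴸ Γ′))
    unique = subst Unique (sym (map-++ proj₁ Γ Γ′))
                   (Unique.++⁺ u (canon-unique K (types Γ))
                               (λ (v∈Γ , v∈Γ′) → All.lookup fresh v∈Γ v∈Γ′))
    pair : Γ ++ᴸ Γ′ ++ᴸ [] ⊢ vars Γ ++ᴸ vars Γ′ ∶ types Γ ++ᴸ types Γ
    pair = subst (_⊢ vars Γ ++ᴸ vars Γ′ ∶ types Γ ++ᴸ types Γ) (cong (Γ ++ᴸ_) (sym (++-identityʳ Γ′)))
                 (tensor (⊢-identity Γ u) (canon-id K (types Γ)) unique)
    term = (vars Γ ++ᴸ vars Γ′) [ vars Γ / vars Γ′ ]
    length-vars≡ : length (vars Γ′) ≡ length (vars Γ)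
    length-vars≡ = trans (length-map proj₁ Γ′) (trans (length-canon K (types Γ))
                                                (trans (length-map proj₂ Γ) (sym (length-map proj₁ Γ))))
    term≡ : term ≡ vars Γ ++ᴸ vars Γ
    term≡ = trans (map-++ _ (vars Γ) (vars Γ′))
                  (cong₂ _++ᴸ_ (substitute-fresh fresh)
                               (substitute-self (canon-unique K (types Γ)) length-vars≡))

  realise : ∀ {n m} {φ : Fin n → Fin m} → InS φ →
            ∀ Γ → Unique (vars Γ) → length Γ ≡ m → Realisation Γ φ
  realise idS Γ u eq = realisation (⊢-identity Γ u) (∘ᶜ-id eq)
  realise (compS {g = g} {f} g∈S f∈S) Γ u eq with realise g∈S Γ u eq
  ... | realisation {s} {B} d Γ∘g
    with realise f∈S (canon 0 B) (canon-unique 0 B) (trans (length-canon 0 B) (length≡ (types≐ Γ∘g)))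
  ... | realisation e Δ∘f =
    realisation (substitution (subst (Γ ⊢ s ∶_) (sym (canon-types 0 B)) d) e)
                (∘ᶜ-cong (λ i → cong (toℕ ∘ g) (cast-is-id refl (f i)))
                         (∘ᶜ-substitute refl (canon-unique 0 B)
                                        (subst (Γ ∘ᶜ g ≐ s ∶_) (sym (canon-types 0 B)) Γ∘g) Δ∘f))
  realise (sumS f∈S g∈S) Γ u eq with ++-split _ Γ eq
  ... | Γ₁ , Γ₂ , eq₁ , eq₂ , refl =
    realise-⊕ u eq₁ eq₂ (realise f∈S Γ₁ (proj₁ parts) eq₁)
                        (realise g∈S Γ₂ (proj₁ (proj₂ parts)) eq₂)
    where parts = Unique-++⁻ (vars Γ₁) (subst Unique (map-++ proj₁ Γ₁ Γ₂) u)
  realise (extS f≗g f∈S) Γ u eq with realise f∈S Γ u eq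
  ... | realisation d Γ∘f = realisation d (∘ᶜ-cong (cong toℕ ∘ f≗g) Γ∘f)
  realise (genW w) Γ u eq =
    realisation (subst (_⊢ [] ∶ []) (++-identityʳ Γ)
                   (weaken {[]} {Γ} {[]} w unit (subst (Unique ∘ vars) (sym (++-identityʳ Γ)) u)))
                (∘ᴸ-initial , ∘ᴸ-initial)
  realise (genE x σ τ στ τσ) Γ u refl = realise-permutation x Γ u (permutation σ τ στ τσ)
  realise (genC c) Γ u eq = realise-contraction c Γ u eq

  -- The isomorphism

  open LHom
  open CHom

  module _ {X : Set} {xs ys : List X} {φ : Fin (length ys) → Fin (length xs)} where

    ∘ᴸ⇒commutes : xs ∘ᴸ φ ≐ ys → ∀ i → lookupⱽ (fromList xs) (φ i) ≡ lookupⱽ (fromList ys) i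
    ∘ᴸ⇒commutes r i =
      just-injective (trans (sym (!-fromList xs (φ i))) (trans (lookup≡ r i) (!-fromList ys i)))

    commutes⇒∘ᴸ : (∀ i → lookupⱽ (fromList xs) (φ i) ≡ lookupⱽ (fromList ys) i) → xs ∘ᴸ φ ≐ ys
    commutes⇒∘ᴸ comm = record
      { length≡ = refl
      ; lookup≡ = λ i → trans (!-fromList xs (φ i)) (trans (cong just (comm i)) (sym (!-fromList ys i))) }

  typeObj : Type → CObj
  typeObj A = length A , fromList A

  typeObj-++ : ∀ A C → typeObj (A ++ᴸ C) ≡ typeObj A ⊗C typeObj C
  typeObj-++ [] C = refl
  typeObj-++ (a ∷ A) C = cong (λ (n , T) → suc n , a ∷ⱽ T) (typeObj-++ A C)

  typeObj-toList : ∀ X → typeObj (toList (proj₂ X)) ≡ X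
  typeObj-toList (zero , []ⱽ) = refl
  typeObj-toList (suc n , a ∷ⱽ T) = cong (λ (n , T) → suc n , a ∷ⱽ T) (typeObj-toList (n , T))

  termArrow : ∀ {A B} → LHom A B → CHom (typeObj B) (typeObj A)
  termArrow {A} {B} (lhom Γ Γ:A t d) = chom (cast e ∘ arrow) (compS (cast∈S e) arrow∈S) (∘ᴸ⇒commutes A∘arrow)
    where
    open StructuralMap (⊢-structuralMap d)
    e : length Γ ≡ length A
    e = length-types Γ:A
    A∘arrow : A ∘ᴸ cast e ∘ arrow ≐ B
    A∘arrow = ∘ᴸ-cong (λ i → sym (toℕ-cast e (arrow i))) (subst (_∘ᴸ arrow ≐ B) Γ:A (types≐ reads))

  termArrow-reads : ∀ {A B} (f : LHom A B) → ctx f ∘ᶜ fun (termArrow f) ≐ term f ∶ B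
  termArrow-reads (lhom Γ Γ:A t d) = ∘ᶜ-cong (λ i → sym (toℕ-cast _ (arrow i))) reads
    where open StructuralMap (⊢-structuralMap d)

  termArrow-renames : ∀ {A B} (f : LHom A B) {z : List Var} → length z ≡ length A →
                      z ∘ᴸ fun (termArrow f) ≐ term f [ z / vars (ctx f) ]
  termArrow-renames f@(lhom Γ Γ:A t d) eq =
    ∘ᴸ-substitute (⊢-unique d) (trans (length-map proj₁ Γ) (trans (length-types Γ:A) (sym eq)))
                  (vars≐ (termArrow-reads f))

  length-vars-canon : ∀ k A → length (vars (canon k A)) ≡ length A
  length-vars-canon k A = trans (length-map proj₁ (canon k A)) (length-canon k A)

  termArrow-resp-≈ : ∀ {A B} {f g : LHom A B} → f ≈L g → termArrow f ≈C termArrow g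
  termArrow-resp-≈ {f = f} {g} (z , |z| , uz , f≡g) i =
    toℕ-injective (∘ᴸ-injective uz (termArrow-renames f |z|)
                                   (subst (_ ∘ᴸ _ ≐_) (sym f≡g) (termArrow-renames g |z|)) i)

  termArrow-id : ∀ {A} → termArrow (idL {A}) ≈C chom id idS (λ _ → refl)
  termArrow-id {A} i = toℕ-injective
    (∘ᴸ-injective (canon-unique 0 A) (vars≐ (termArrow-reads (idL {A}))) (∘ᴸ-id (length-vars-canon 0 A)) i)

  termArrow-∘ : ∀ {A B C} (g : LHom B C) (f : LHom A B) →
                ∀ i → fun (termArrow (g ∘L f)) i ≡ fun (termArrow f) (fun (termArrow g) i)
  termArrow-∘ (lhom Δ refl t e) (lhom Γ Γ:A s d) i = refl

  fun-subst₂ : ∀ {X X′ Y Y′ : CObj} (p : X ≡ X′) (q : Y ≡ Y′) (h : CHom Y X) i →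
               toℕ (fun (subst₂ (λ X Y → CHom Y X) p q h) i) ≡ toℕ (fun h (cast (cong proj₁ (sym q)) i))
  fun-subst₂ refl refl h i = cong (toℕ ∘ fun h) (sym (cast-is-id refl i))

  termArrow-⊗-toℕ : ∀ {A B C D} (f : LHom A B) (g : LHom C D) j →
                    toℕ (fun (termArrow (f ⊗L g)) j)
                    ≡ toℕ ((fun (termArrow f) ⊕ fun (termArrow g)) (cast (length-++ B) j))
  termArrow-⊗-toℕ {A} {B} {C} f g =
    ∘ᴸ-injective (canon-unique 0 (A ++ᴸ C)) (vars≐ (termArrow-reads (f ⊗L g))) blockwise
    where
    φ⊕ψ = fun (termArrow f) ⊕ fun (termArrow g)
    zᴬ = vars (canon 0 A)
    zᶜ = vars (canon (0 + length A) C)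
    z≡ : zᴬ ++ᴸ zᶜ ≡ vars (canon 0 (A ++ᴸ C))
    z≡ = trans (sym (map-++ proj₁ (canon 0 A) _)) (cong vars (canon-++ 0 A C))
    ⊕-renames : zᴬ ++ᴸ zᶜ ∘ᴸ φ⊕ψ ≐ term (f ⊗L g)
    ⊕-renames = ∘ᴸ-⊕ (length-vars-canon 0 A) (length-vars-canon (0 + length A) C)
                     (termArrow-renames f (length-vars-canon 0 A))
                     (termArrow-renames g (length-vars-canon (0 + length A) C))
    blockwise : vars (canon 0 (A ++ᴸ C)) ∘ᴸ φ⊕ψ ∘ cast (length-++ B) ≐ term (f ⊗L g)
    blockwise = ∘ᴸ-∘ (subst (_∘ᴸ φ⊕ψ ≐ term (f ⊗L g)) z≡ ⊕-renames)
                     (∘ᴸ-cast (trans (length≡ ⊕-renames) (sym (length-++ B))) (length-++ B))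

  termArrow-⊗ : ∀ {A B C D} (f : LHom A B) (g : LHom C D) i →
                fun (subst₂ (λ X Y → CHom Y X) (typeObj-++ A C) (typeObj-++ B D) (termArrow (f ⊗L g))) i
                ≡ (fun (termArrow f) ⊕ fun (termArrow g)) i
  termArrow-⊗ {A} {B} {C} {D} f g i = toℕ-injective (begin
    toℕ (fun (subst₂ (λ X Y → CHom Y X) (typeObj-++ A C) (typeObj-++ B D) h) i)
                                                ≡⟨ fun-subst₂ (typeObj-++ A C) (typeObj-++ B D) h i ⟩
    toℕ (fun h (cast e i))                      ≡⟨ termArrow-⊗-toℕ f g (cast e i) ⟩
    toℕ (φ⊕ψ (cast (length-++ B) (cast e i)))  ≡⟨ cong (toℕ ∘ φ⊕ψ) (cast-involutive (length-++ B) e i) ⟩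
    toℕ (φ⊕ψ i)                                ∎)
    where
    open ≡-Reasoning
    h = termArrow (f ⊗L g)
    φ⊕ψ = fun (termArrow f) ⊕ fun (termArrow g)
    e = cong proj₁ (sym (typeObj-++ B D))

  termArrow-injective : ∀ {A B} (f g : LHom A B) → termArrow f ≈C termArrow g → f ≈L g
  termArrow-injective {A} f g f≈g =
    vars (canon 0 A) , length-vars-canon 0 A , canon-unique 0 A ,
    ∘ᴸ-functional (termArrow-renames f (length-vars-canon 0 A))
                  (∘ᴸ-cong (λ i → cong toℕ (sym (f≈g i))) (termArrow-renames g (length-vars-canon 0 A)))

  termArrow-surjective : ∀ {A B} (h : CHom (typeObj B) (typeObj A)) →
                         Σ (LHom A B) λ f → termArrow f ≈C h
  termArrow-surjective {A} {B} h with realise (inS h) (canon 0 A) (canon-unique 0 A) (length-canon 0 A)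
  ... | realisation {t} d (vs , ts) =
    f , λ i → toℕ-injective (∘ᴸ-injective (canon-unique 0 A) (vars≐ (termArrow-reads f)) vs i)
    where
    type≡B = ∘ᴸ-functional (subst (_∘ᴸ fun h ≐ _) (canon-types 0 A) ts) (commutes⇒∘ᴸ (comm h))
    f = lhom (canon 0 A) (canon-types 0 A) t (subst (canon 0 A ⊢ t ∶_) type≡B d)

proposition5p4 : (Atom : Set) (S : StructRules) →
    MonIso (TermCat Atom S) (Op (CommaCat Atom S))
proposition5p4 Atom S = record
  { F₀ = typeObj ; F₁ = termArrow
  ; F-resp = λ {A} {B} {f} {g} → termArrow-resp-≈ {A} {B} {f} {g}
  ; F-id = λ {A} → termArrow-id {A} ; F-∘ = termArrow-∘
  ; F-unit = refl ; F-⊗₀ = typeObj-++ ; F-⊗₁ = termArrow-⊗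
  ; G₀ = toList ∘ proj₂ ; G₀F₀ = toList∘fromList ; F₀G₀ = typeObj-toList
  ; F-inj = termArrow-injective ; F-surj = termArrow-surjective }
  where open TermCategory Atom S
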